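{- (a) For every integer $j\geqslant1$, the periodic word ${\tt w}=({\tt a}^j{\tt b}^j)^\omega$ satisfies $r(n)=j$ for all $n\geqslant1$. (b) Let $k,j$ be integers with $0\leqslant j\leqslant k-1$ and let ${\tt w}$ be the one-sided fixed point of $\sigma_{k-j,j,1}$. Then $r(n)=kn-j$ for all $n\geqslant1$. (c) Let $k\geqslant1$ be an integer and ${\tt w}$ the one-sided fixed point of $\sigma_{1,k-1,1}$. Then $r_{D({\tt w})}(n)=kn+1$ for all $n\geqslant1$.
   Context: For integers $k,m\geqslant1$, $l\geqslant0$, $\sigma_{k,l,m}$ is the substitution ${\tt a}\mapsto{\tt a}^k{\tt b}{\tt a}^l,\ {\tt b}\mapsto{\tt a}^m$; its one-sided fixed point is the limit of $\sigma_{k,l,m}^n({\tt a})$. $({\tt a}^j{\tt b}^j)^\omega$ is the infinite periodic repetition of ${\tt a}^j{\tt b}^j$. $D$ deletes the first ${\tt a}$ and the first ${\tt b}$ of a word. Words are indexed from position $0$; $p_{\tt a}(n)$, $p_{\tt b}(n)$ are the positions of the $n$-th ${\tt a}$ and $n$-th ${\tt b}$ and $r(n)=r_{\tt w}(n)=p_{\tt b}(n)-p_{\tt a}(n)$. -}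

module Defs where

open import Data.Nat using (ℕ; zero; suc; _+_; _*_; _∸_; _≤_; _<_)
open import Data.Nat.DivMod using (_%_)
open import Data.List using (List; []; _∷_; _++_; replicate; concatMap; length)
open import Data.Maybe using (Maybe; just; nothing)
open import Data.Product using (Σ; ∃; _×_; _,_)
open import Data.Integer as ℤ using (ℤ; +_)
open import Relation.Binary.PropositionalEquality using (_≡_)
open import Relation.Nullary using (¬_)

data Letter : Set where
  a b : Letter

Word : Set
Word = ℕ → Letter

_==_ : Letter → Letter → ℕ
a == a = 1
b == b = 1
a == b = 0
b == a = 0

count : Word → Letter → ℕ → ℕ
count w x zero = 0
count w x (suc p) = count w x p + (w p == x)

-- p is the position of the n-th occurrence (n ≥ 1) of x in w
NthOcc : Word → Letter → ℕ → ℕ → Set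
NthOcc w x n p = (w p ≡ x) × (suc (count w x p) ≡ n)

-- r_w(n) = p_b(n) - p_a(n)  (the n-th a and n-th b exist and their distance is z)
HasR : Word → ℕ → ℤ → Set
HasR w n z = Σ ℕ λ pa → Σ ℕ λ pb →
  NthOcc w a n pa × NthOcc w b n pb × ((+ pb) ℤ.- (+ pa) ≡ z)

at : List Letter → ℕ → Maybe Letter
at [] i = nothing
at (x ∷ xs) zero = just x
at (x ∷ xs) (suc i) = at xs i

-- u^ω for a nonempty finite word u (the empty case is junk and unused)
omega : List Letter → Word
omega [] i = a
omega (x ∷ xs) i with at (x ∷ xs) (i % suc (length xs))
... | just y = y
... | nothing = a

periodicAB : ℕ → Word
periodicAB j = omega (replicate j a ++ replicate j b)

σ : ℕ → ℕ → ℕ → Letter → List Letter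
σ k l m a = replicate k a ++ (b ∷ replicate l a)
σ k l m b = replicate m a

σ* : ℕ → ℕ → ℕ → List Letter → List Letter
σ* k l m = concatMap (σ k l m)

σpow : ℕ → ℕ → ℕ → ℕ → List Letter
σpow k l m zero = a ∷ []
σpow k l m (suc n) = σ* k l m (σpow k l m n)

-- w is the limit of σ^n(a) (the one-sided fixed point): every letter of w
-- is eventually the letter at that position of σ^n(a)
IsFixedPoint : ℕ → ℕ → ℕ → Word → Set
IsFixedPoint k l m w =
  ∀ i → Σ ℕ λ N → ∀ n → N ≤ n → at (σpow k l m n) i ≡ just (w i)

DeleteFirst : Letter → Word → Word → Set
DeleteFirst x w v = Σ ℕ λ p →
  (w p ≡ x) × (∀ q → q < p → ¬ (w q ≡ x)) ×
  (∀ i → i < p → v i ≡ w i) × (∀ i → p ≤ i → v i ≡ w (suc i))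

IsD : Word → Word → Set
IsD w v = Σ Word λ u → DeleteFirst a w u × DeleteFirst b u v

-- The fixed point w of σ = σ_{k,l,1} satisfies σ(w) = w, so σ maps prefixes of w to prefixes of w.
-- If the (m+1)-th a of w is at position A, then u = w[0..A) contains m a's and u a is a prefix of w,
-- hence so is σ(u) a^k b a^l.  That b has one b before it for each a of u, so it is the (m+1)-th b,
-- and it sits at |σ(u)| + k = A + (k+l)m + k; thus r(m+1) = (k+l)(m+1) - l.  For σ_{1,k-1,1} the
-- fixed point starts with ab, so D(w) is w shifted by two and its n-th a and n-th b are the
-- (n+1)-th ones of w.  The periodic word is a direct count.
module Submission where

open import Defs
open import Data.Integer as ℤ using (+_)
import Data.Integer.Properties as ℤP
open import Data.List using (List; []; _∷_; _++_; _∷ʳ_; replicate; length; map; applyUpTo)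
open import Data.List.Properties
  using (length-++; length-++-≤ˡ; ++-assoc; ++-identityʳ; map-++; concatMap-++; length-replicate; length-applyUpTo; applyUpTo-∷ʳ)
open import Data.Maybe using (just; nothing)
open import Data.Maybe.Properties using (just-injective)
open import Data.Nat using (ℕ; zero; suc; _+_; _*_; _∸_; _≤_; _<_; _⊔_; z≤n; s≤s; _<?_; NonZero; >-nonZero)
open import Data.Nat.DivMod using (_%_; _/_; m≡m%n+[m/n]*n; m%n<n; [m+kn]%n≡m%n; m<n⇒m%n≡m)
open import Data.Nat.ListAction using (sum)
open import Data.Nat.ListAction.Properties using (sum-++)
open import Data.Nat.Properties hiding (_≟_)
open import Data.Nat.Tactic.RingSolver using (solve-∀)
open import Data.Product using (Σ; _×_; _,_; proj₁; proj₂)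
open import Data.Sum using (inj₁; inj₂)
open import Function using (_∘_)
open import Relation.Binary.Definitions using (DecidableEquality)
open import Relation.Binary.PropositionalEquality
open import Relation.Nullary using (yes; no; contradiction)

open ≡-Reasoning

+[m+n]-+m≡+n : ∀ m n → + (m + n) ℤ.- + m ≡ + n
+[m+n]-+m≡+n m n = begin
  + (m + n) ℤ.- + m  ≡⟨ ℤP.[+m]-[+n]≡m⊖n (m + n) m ⟩
  (m + n) ℤ.⊖ m      ≡⟨ ℤP.⊖-≥ (m≤m+n m n) ⟩
  + (m + n ∸ m)      ≡⟨ cong +_ (m+n∸m≡n m n) ⟩
  + n                ∎

_≟_ : DecidableEquality Letter
a ≟ a = yes refl
a ≟ b = no λ ()
b ≟ a = no λ ()
b ≟ b = yes refl

==-refl : ∀ x → (x == x) ≡ 1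
==-refl a = refl
==-refl b = refl

==-≢ : ∀ {x y} → x ≢ y → (x == y) ≡ 0
==-≢ {a} {a} x≢y = contradiction refl x≢y
==-≢ {a} {b} _   = refl
==-≢ {b} {a} _   = refl
==-≢ {b} {b} x≢y = contradiction refl x≢y

==-partition : ∀ x → (a == x) + (b == x) ≡ 1
==-partition a = refl
==-partition b = refl

count-step-≡ : ∀ w {x p} → w p ≡ x → count w x (suc p) ≡ suc (count w x p)
count-step-≡ w {p = p} refl = trans (cong (_+_ (count w (w p) p)) (==-refl (w p))) (+-comm _ 1)

count-step-≢ : ∀ w {x p} → w p ≢ x → count w x (suc p) ≡ count w x p
count-step-≢ w wp≢x = trans (cong (_+_ _) (==-≢ wp≢x)) (+-identityʳ _)

nth-occurrence : ∀ w x m Q → m < count w x Q → Σ ℕ (NthOcc w x (suc m))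
nth-occurrence w x m (suc Q) m<count with m <? count w x Q | w Q ≟ x
... | yes m<count′ | _ = nth-occurrence w x m Q m<count′
... | no m≮count′ | no wQ≢x = contradiction (subst (m <_) (count-step-≢ w wQ≢x) m<count) m≮count′
... | no m≮count′ | yes wQ≡x =
  Q , wQ≡x , cong suc (≤-antisym (≮⇒≥ m≮count′) (≤-pred (subst (m <_) (count-step-≡ w wQ≡x) m<count)))

count-run : ∀ w x y s r → (∀ i → i < r → w (s + i) ≡ x) → count w y (s + r) ≡ count w y s + r * (x == y)
count-run w x y s zero _ = trans (cong (count w y) (+-identityʳ s)) (sym (+-identityʳ _))
count-run w x y s (suc r) run = begin
  count w y (s + suc r)                   ≡⟨ cong (count w y) (+-suc s r) ⟩
  count w y (s + r) + (w (s + r) == y)    ≡⟨ cong₂ _+_ (count-run w x y s r (λ i → run i ∘ m<n⇒m<1+n))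
                                                       (cong (_== y) (run r ≤-refl)) ⟩
  count w y s + r * (x == y) + (x == y)   ≡⟨ +-assoc (count w y s) _ _ ⟩
  count w y s + (r * (x == y) + (x == y)) ≡⟨ cong (_+_ (count w y s)) (+-comm (r * (x == y)) _) ⟩
  count w y s + suc r * (x == y)          ∎

count-shift : ∀ w {v} d x → (∀ i → v i ≡ w (d + i)) → ∀ p → count w x (d + p) ≡ count w x d + count v x p
count-shift w d x v≗ zero = trans (cong (count w x) (+-identityʳ d)) (sym (+-identityʳ _))
count-shift w {v} d x v≗ (suc p) = begin
  count w x (d + suc p)                  ≡⟨ cong (count w x) (+-suc d p) ⟩
  count w x (d + p) + (w (d + p) == x)   ≡⟨ cong₂ _+_ (count-shift w d x v≗ p) (cong (_== x) (sym (v≗ p))) ⟩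
  count w x d + count v x p + (v p == x) ≡⟨ +-assoc (count w x d) _ _ ⟩
  count w x d + count v x (suc p)        ∎

NthOcc-shift : ∀ w {v} d {x c n p} → (∀ i → v i ≡ w (d + i)) → count w x d ≡ c →
               NthOcc w x (c + n) (d + p) → NthOcc v x n p
NthOcc-shift w {v} d {x} {c} {n} {p} v≗ count≡c (wx , count≡) = trans (v≗ p) wx , +-cancelˡ-≡ c _ _ (begin
  c + suc (count v x p)           ≡⟨ +-suc c _ ⟩
  suc (c + count v x p)           ≡⟨ cong (λ c′ → suc (c′ + count v x p)) count≡c ⟨
  suc (count w x d + count v x p) ≡⟨ cong suc (count-shift w d x v≗ p) ⟨
  suc (count w x (d + p))         ≡⟨ count≡ ⟩
  c + n                           ∎)

listCount : Letter → List Letter → ℕ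
listCount x = sum ∘ map (_== x)

listCount-++ : ∀ x xs ys → listCount x (xs ++ ys) ≡ listCount x xs + listCount x ys
listCount-++ x xs ys = trans (cong sum (map-++ (_== x) xs ys)) (sum-++ (map (_== x) xs) _)

listCount-replicate : ∀ n x y → listCount y (replicate n x) ≡ n * (x == y)
listCount-replicate zero    x y = refl
listCount-replicate (suc n) x y = cong (_+_ (x == y)) (listCount-replicate n x y)

at-++ˡ : ∀ xs ys {i} → i < length xs → at (xs ++ ys) i ≡ at xs i
at-++ˡ (x ∷ xs) ys {zero}  _         = refl
at-++ˡ (x ∷ xs) ys {suc i} (s≤s i<n) = at-++ˡ xs ys i<n

at-++ʳ : ∀ xs ys i → at (xs ++ ys) (length xs + i) ≡ at ys i
at-++ʳ []       ys i = refl
at-++ʳ (x ∷ xs) ys i = at-++ʳ xs ys i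

at-replicate : ∀ n x {i} → i < n → at (replicate n x) i ≡ just x
at-replicate (suc n) x {zero}  _         = refl
at-replicate (suc n) x {suc i} (s≤s i<n) = at-replicate n x i<n

at-just⇒< : ∀ u {i y} → at u i ≡ just y → i < length u
at-just⇒< (x ∷ u) {zero}  _   = s≤s z≤n
at-just⇒< (x ∷ u) {suc i} eq = s≤s (at-just⇒< u eq)

Agree : ℕ → List Letter → Word → Set
Agree L v w = ∀ i → i < L → at v i ≡ just (w i)

_IsPrefixOf_ : List Letter → Word → Set
u IsPrefixOf w = Agree (length u) u w

prefix : Word → ℕ → List Letter
prefix = applyUpTo

Agree-≤ : ∀ {L L′} v {w} → L′ ≤ L → Agree L v w → Agree L′ v w
Agree-≤ v L′≤L agree i i<L′ = agree i (<-≤-trans i<L′ L′≤L)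

Agree-++ˡ : ∀ xs {ys w} → Agree (length xs) (xs ++ ys) w → xs IsPrefixOf w
Agree-++ˡ xs agree i i<n = trans (sym (at-++ˡ xs _ i<n)) (agree i i<n)

IsPrefixOf-++ˡ : ∀ xs {ys w} → (xs ++ ys) IsPrefixOf w → xs IsPrefixOf w
IsPrefixOf-++ˡ xs xs++ys≺w = Agree-++ˡ xs (Agree-≤ (xs ++ _) (length-++-≤ˡ xs) xs++ys≺w)

IsPrefixOf-++-∷ : ∀ xs {y ys w} → (xs ++ y ∷ ys) IsPrefixOf w → w (length xs) ≡ y
IsPrefixOf-++-∷ xs {y} {ys} ≺w = just-injective (trans (sym (≺w _ (at-just⇒< (xs ++ y ∷ ys) at≡y))) at≡y)
  where
  at≡y : at (xs ++ y ∷ ys) (length xs) ≡ just y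
  at≡y = subst (λ i → at (xs ++ y ∷ ys) i ≡ just y) (+-identityʳ _) (at-++ʳ xs (y ∷ ys) 0)

at-prefix : ∀ w n {i} → i < n → at (prefix w n) i ≡ just (w i)
at-prefix w (suc n) {zero}  _         = refl
at-prefix w (suc n) {suc i} (s≤s i<n) = at-prefix (w ∘ suc) n i<n

prefix-IsPrefixOf : ∀ w n → prefix w n IsPrefixOf w
prefix-IsPrefixOf w n i i<n = at-prefix w n (subst (i <_) (length-applyUpTo w n) i<n)

IsPrefixOf⇒≡prefix : ∀ u {w} → u IsPrefixOf w → u ≡ prefix w (length u)
IsPrefixOf⇒≡prefix []      _   = refl
IsPrefixOf⇒≡prefix (x ∷ u) ≺w =
  cong₂ _∷_ (just-injective (≺w 0 (s≤s z≤n))) (IsPrefixOf⇒≡prefix u (λ i → ≺w (suc i) ∘ s≤s))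

Agree⇒++ : ∀ u v {w} → u IsPrefixOf w → Agree (length u) v w → Σ (List Letter) λ rest → v ≡ u ++ rest
Agree⇒++ []      v _  _     = v , refl
Agree⇒++ (x ∷ u) [] _ agree with () ← agree 0 (s≤s z≤n)
Agree⇒++ (x ∷ u) (y ∷ v) ≺w agree =
  let rest , v≡ = Agree⇒++ u v (λ i → ≺w (suc i) ∘ s≤s) (λ i → agree (suc i) ∘ s≤s)
  in rest , cong₂ _∷_ (just-injective (trans (agree 0 (s≤s z≤n)) (sym (≺w 0 (s≤s z≤n))))) v≡

count-prefix : ∀ w x n → count w x n ≡ listCount x (prefix w n)
count-prefix w x zero    = refl
count-prefix w x (suc n) = begin
  count w x n + (w n == x)                                 ≡⟨ cong₂ _+_ (count-prefix w x n) (sym (+-identityʳ _)) ⟩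
  listCount x (prefix w n) + listCount x (w n ∷ [])        ≡⟨ listCount-++ x (prefix w n) _ ⟨
  listCount x (prefix w n ∷ʳ w n)                          ≡⟨ cong (listCount x) (applyUpTo-∷ʳ w n) ⟩
  listCount x (prefix w (suc n))                           ∎

count-IsPrefixOf : ∀ u {w} x → u IsPrefixOf w → count w x (length u) ≡ listCount x u
count-IsPrefixOf u {w} x ≺w = trans (count-prefix w x (length u)) (cong (listCount x) (sym (IsPrefixOf⇒≡prefix u ≺w)))

agree-eventually : ∀ (f : ℕ → List Letter) {w} → (∀ i → Σ ℕ λ N → ∀ n → N ≤ n → at (f n) i ≡ just (w i)) →
                   ∀ L → Σ ℕ λ N → ∀ n → N ≤ n → Agree L (f n) w
agree-eventually f conv zero = 0 , λ _ _ _ ()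
agree-eventually f {w} conv (suc L) with agree-eventually f conv L | conv L
... | N , agreeL | N′ , atL = N ⊔ N′ , agree
  where
  agree : ∀ n → N ⊔ N′ ≤ n → Agree (suc L) (f n) w
  agree n N⊔N′≤n i i<1+L with m<1+n⇒m<n∨m≡n i<1+L
  ... | inj₁ i<L  = agreeL n (≤-trans (m≤m⊔n N N′) N⊔N′≤n) i i<L
  ... | inj₂ refl = atL n (≤-trans (m≤n⊔m N N′) N⊔N′≤n)

length-σ : ∀ k l x → length (σ k l 1 x) ≡ suc ((k + l) * (x == a))
length-σ k l a = begin
  length (replicate k a ++ b ∷ replicate l a)           ≡⟨ length-++ (replicate k a) ⟩
  length (replicate k a) + suc (length (replicate l a)) ≡⟨ cong₂ (λ m n → m + suc n) (length-replicate k) (length-replicate l) ⟩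
  k + suc l                                             ≡⟨ +-suc k l ⟩
  suc (k + l)                                           ≡⟨ cong suc (*-identityʳ (k + l)) ⟨
  suc ((k + l) * 1)                                     ∎
length-σ k l b = cong suc (sym (*-zeroʳ (k + l)))

length-σ* : ∀ k l u → length (σ* k l 1 u) ≡ length u + (k + l) * listCount a u
length-σ* k l []      = sym (*-zeroʳ (k + l))
length-σ* k l (x ∷ u) = begin
  length (σ k l 1 x ++ σ* k l 1 u)                      ≡⟨ length-++ (σ k l 1 x) ⟩
  length (σ k l 1 x) + length (σ* k l 1 u)              ≡⟨ cong₂ _+_ (length-σ k l x) (length-σ* k l u) ⟩
  suc ((k + l) * (x == a)) + (length u + (k + l) * listCount a u)
    ≡⟨ regroup (k + l) (x == a) (length u) (listCount a u) ⟩
  suc (length u) + (k + l) * ((x == a) + listCount a u) ∎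
  where
  regroup : ∀ K e L c → suc (K * e) + (L + K * c) ≡ suc L + K * (e + c)
  regroup = solve-∀

listCount-b-σ : ∀ k l m x → listCount b (σ k l m x) ≡ (x == a)
listCount-b-σ k l m a = begin
  listCount b (replicate k a ++ b ∷ replicate l a)               ≡⟨ listCount-++ b (replicate k a) _ ⟩
  listCount b (replicate k a) + suc (listCount b (replicate l a)) ≡⟨ cong₂ (λ m n → m + suc n) (listCount-replicate k a b) (listCount-replicate l a b) ⟩
  k * 0 + suc (l * 0)                                             ≡⟨ cong₂ (λ m n → m + suc n) (*-zeroʳ k) (*-zeroʳ l) ⟩
  1                                                               ∎
listCount-b-σ k l m b = trans (listCount-replicate m a b) (*-zeroʳ m)

listCount-b-σ* : ∀ k l m u → listCount b (σ* k l m u) ≡ listCount a u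
listCount-b-σ* k l m []      = refl
listCount-b-σ* k l m (x ∷ u) =
  trans (listCount-++ b (σ k l m x) _) (cong₂ _+_ (listCount-b-σ k l m x) (listCount-b-σ* k l m u))

listCount-a-σ-pos : ∀ k l m .{{_ : NonZero k}} .{{_ : NonZero m}} x → 1 ≤ listCount a (σ k l m x)
listCount-a-σ-pos (suc k) l m a = s≤s z≤n
listCount-a-σ-pos k l (suc m) b = s≤s z≤n

length≤listCount-a-σ* : ∀ k l m .{{_ : NonZero k}} .{{_ : NonZero m}} u → length u ≤ listCount a (σ* k l m u)
length≤listCount-a-σ* k l m []      = z≤n
length≤listCount-a-σ* k l m (x ∷ u) = subst (suc (length u) ≤_) (sym (listCount-++ a (σ k l m x) _))
  (+-mono-≤ (listCount-a-σ-pos k l m x) (length≤listCount-a-σ* k l m u))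

σpow-head : ∀ k l m .{{_ : NonZero k}} n → Σ (List Letter) λ rest → σpow k l m n ≡ a ∷ rest
σpow-head k       l m zero    = [] , refl
σpow-head (suc k) l m (suc n) = _ , cong (σ* (suc k) l m) (proj₂ (σpow-head (suc k) l m n))

module FixedPoint (k l : ℕ) {w : Word} (fp : IsFixedPoint k l 1 w) where

  head-a : .{{_ : NonZero k}} → w 0 ≡ a
  head-a = let N , atN = fp 0 in
    just-injective (trans (sym (atN N ≤-refl)) (cong (λ v → at v 0) (proj₂ (σpow-head k l 1 N))))

  -- σᴺ(a) begins with u for large N, so σᴺ⁺¹(a) begins with σ(u).
  σ*-IsPrefixOf : ∀ u → u IsPrefixOf w → σ* k l 1 u IsPrefixOf w
  σ*-IsPrefixOf u u≺w =
    let L = length u + length (σ* k l 1 u)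
        N , agree = agree-eventually (σpow k l 1) fp L
        rest , σᴺa≡ = Agree⇒++ u (σpow k l 1 N) u≺w (Agree-≤ (σpow k l 1 N) (m≤m+n _ _) (agree N ≤-refl))
        σᴺ⁺¹a≡ = trans (cong (σ* k l 1) σᴺa≡) (concatMap-++ (σ k l 1) u rest)
    in Agree-++ˡ (σ* k l 1 u)
         (subst (λ v → Agree _ v w) σᴺ⁺¹a≡ (Agree-≤ (σpow k l 1 (suc N)) (m≤n+m _ _) (agree (suc N) (n≤1+n N))))

  nth-a-exists : .{{_ : NonZero k}} → ∀ m → Σ ℕ (NthOcc w a (suc m))
  nth-a-exists m = nth-occurrence w a m (length (σ* k l 1 u))
    (subst₂ _≤_ (length-applyUpTo w (suc m)) (sym (count-IsPrefixOf (σ* k l 1 u) a σu≺w)) (length≤listCount-a-σ* k l 1 u))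
    where
    u = prefix w (suc m)
    σu≺w = σ*-IsPrefixOf u (prefix-IsPrefixOf w (suc m))

  nth-b-after-nth-a : ∀ {m A} → NthOcc w a (suc m) A → NthOcc w b (suc m) (A + (k + l) * m + k)
  nth-b-after-nth-a {m} {A} (wA≡a , count≡) =
    subst (NthOcc w b (suc m)) |V|≡ (IsPrefixOf-++-∷ V V∷b≺w , cong suc count-b-V)
    where
    u = prefix w A
    V = σ* k l 1 u ++ replicate k a
    u∷a≺w : (u ∷ʳ a) IsPrefixOf w
    u∷a≺w = subst (_IsPrefixOf w) (trans (sym (applyUpTo-∷ʳ w A)) (cong (u ∷ʳ_) wA≡a)) (prefix-IsPrefixOf w (suc A))
    image : σ* k l 1 (u ∷ʳ a) ≡ V ++ b ∷ replicate l a
    image = begin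
      σ* k l 1 (u ++ a ∷ [])                                 ≡⟨ concatMap-++ (σ k l 1) u _ ⟩
      σ* k l 1 u ++ (σ k l 1 a ++ [])                        ≡⟨ cong (σ* k l 1 u ++_) (++-identityʳ _) ⟩
      σ* k l 1 u ++ (replicate k a ++ b ∷ replicate l a)     ≡⟨ ++-assoc (σ* k l 1 u) _ _ ⟨
      V ++ b ∷ replicate l a                                 ∎
    V∷b≺w : (V ++ b ∷ replicate l a) IsPrefixOf w
    V∷b≺w = subst (_IsPrefixOf w) image (σ*-IsPrefixOf (u ∷ʳ a) u∷a≺w)
    count-a-u : listCount a u ≡ m
    count-a-u = trans (sym (count-prefix w a A)) (suc-injective count≡)
    |V|≡ : length V ≡ A + (k + l) * m + k
    |V|≡ = begin
      length (σ* k l 1 u ++ replicate k a)                  ≡⟨ length-++ (σ* k l 1 u) ⟩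
      length (σ* k l 1 u) + length (replicate k a)          ≡⟨ cong₂ _+_ (length-σ* k l u) (length-replicate k) ⟩
      length u + (k + l) * listCount a u + k                ≡⟨ cong₂ (λ L c → L + (k + l) * c + k) (length-applyUpTo w A) count-a-u ⟩
      A + (k + l) * m + k                                   ∎
    count-b-V : count w b (length V) ≡ m
    count-b-V = begin
      count w b (length V)                                  ≡⟨ count-IsPrefixOf V b (IsPrefixOf-++ˡ V V∷b≺w) ⟩
      listCount b (σ* k l 1 u ++ replicate k a)             ≡⟨ listCount-++ b (σ* k l 1 u) _ ⟩
      listCount b (σ* k l 1 u) + listCount b (replicate k a) ≡⟨ cong₂ _+_ (listCount-b-σ* k l 1 u) (listCount-replicate k a b) ⟩
      listCount a u + k * 0                                 ≡⟨ cong₂ _+_ count-a-u (*-zeroʳ k) ⟩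
      m + 0                                                 ≡⟨ +-identityʳ m ⟩
      m                                                     ∎

omega-at : ∀ u {L} → length u ≡ L → ∀ q {r y} → at u r ≡ just y → omega u (q * L + r) ≡ y
omega-at (x ∷ xs) refl q {r} at≡ with at (x ∷ xs) ((q * suc (length xs) + r) % suc (length xs)) | cong (at (x ∷ xs)) index≡
  where
  index≡ : (q * suc (length xs) + r) % suc (length xs) ≡ r
  index≡ = trans (cong (_% suc (length xs)) (+-comm _ r))
                 (trans ([m+kn]%n≡m%n r q _) (m<n⇒m%n≡m (at-just⇒< (x ∷ xs) at≡)))
... | just y′ | at≡′ = just-injective (trans at≡′ at≡)
... | nothing | at≡′ = contradiction (trans at≡′ at≡) λ ()

blockAB : ℕ → List Letter
blockAB j = replicate j a ++ replicate j b

length-blockAB : ∀ j → length (blockAB j) ≡ j + j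
length-blockAB j = trans (length-++ (replicate j a)) (cong₂ _+_ (length-replicate j) (length-replicate j))

periodicAB-a : ∀ j q r → r < j → periodicAB j (q * (j + j) + r) ≡ a
periodicAB-a j q r r<j = omega-at (blockAB j) (length-blockAB j) q
  (trans (at-++ˡ (replicate j a) _ (subst (r <_) (sym (length-replicate j)) r<j)) (at-replicate j a r<j))

periodicAB-b : ∀ j q r → r < j → periodicAB j (q * (j + j) + j + r) ≡ b
periodicAB-b j q r r<j = subst (λ i → periodicAB j i ≡ b) (sym (+-assoc (q * (j + j)) j r))
  (omega-at (blockAB j) (length-blockAB j) q
    (trans (subst (λ n → at (blockAB j) (n + r) ≡ at (replicate j b) r) (length-replicate j) (at-++ʳ (replicate j a) _ r))
           (at-replicate j b r<j)))

count-periodicAB : ∀ j q y → count (periodicAB j) y (q * (j + j)) ≡ q * j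
count-periodicAB j zero    y = refl
count-periodicAB j (suc q) y = begin
  count w y (j + j + q * (j + j))                     ≡⟨ cong (count w y) (trans (+-comm (j + j) _) (sym (+-assoc (q * (j + j)) j j))) ⟩
  count w y (q * (j + j) + j + j)                     ≡⟨ count-run w b y (q * (j + j) + j) j (periodicAB-b j q) ⟩
  count w y (q * (j + j) + j) + j * (b == y)          ≡⟨ cong (_+ j * (b == y)) (count-run w a y (q * (j + j)) j (periodicAB-a j q)) ⟩
  count w y (q * (j + j)) + j * (a == y) + j * (b == y) ≡⟨ cong (λ c → c + j * (a == y) + j * (b == y)) (count-periodicAB j q y) ⟩
  q * j + j * (a == y) + j * (b == y)                 ≡⟨ +-assoc (q * j) _ _ ⟩
  q * j + (j * (a == y) + j * (b == y))               ≡⟨ cong (_+_ (q * j)) (*-distribˡ-+ j (a == y) (b == y)) ⟨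
  q * j + j * ((a == y) + (b == y))                   ≡⟨ cong (λ e → q * j + j * e) (==-partition y) ⟩
  q * j + j * 1                                       ≡⟨ cong (_+_ (q * j)) (*-identityʳ j) ⟩
  q * j + j                                           ≡⟨ +-comm (q * j) j ⟩
  suc q * j                                           ∎
  where
  w = periodicAB j

r-periodicAB : ∀ j → 1 ≤ j → ∀ n → 1 ≤ n → HasR (periodicAB j) n (+ j)
r-periodicAB j@(suc _) _ (suc m) _ =
  pa , pb , (periodicAB-a j q r r<j , cong suc count-a) , (periodicAB-b j q r r<j , cong suc count-b) , distance
  where
  w = periodicAB j
  q = m / j
  r = m % j
  r<j : r < j
  r<j = m%n<n m j
  pa = q * (j + j) + r
  pb = q * (j + j) + j + r
  qj+r≡m : q * j + r ≡ m
  qj+r≡m = trans (+-comm (q * j) r) (sym (m≡m%n+[m/n]*n m j))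
  count-a : count w a pa ≡ m
  count-a = begin
    count w a pa                      ≡⟨ count-run w a a (q * (j + j)) r (λ i i<r → periodicAB-a j q i (<-trans i<r r<j)) ⟩
    count w a (q * (j + j)) + r * 1   ≡⟨ cong₂ _+_ (count-periodicAB j q a) (*-identityʳ r) ⟩
    q * j + r                         ≡⟨ qj+r≡m ⟩
    m                                 ∎
  count-b : count w b pb ≡ m
  count-b = begin
    count w b pb                                 ≡⟨ count-run w b b (q * (j + j) + j) r (λ i i<r → periodicAB-b j q i (<-trans i<r r<j)) ⟩
    count w b (q * (j + j) + j) + r * 1          ≡⟨ cong₂ _+_ (count-run w a b (q * (j + j)) j (periodicAB-a j q)) (*-identityʳ r) ⟩
    count w b (q * (j + j)) + j * 0 + r          ≡⟨ cong₂ (λ c z → c + z + r) (count-periodicAB j q b) (*-zeroʳ j) ⟩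
    q * j + 0 + r                                ≡⟨ cong (_+ r) (+-identityʳ (q * j)) ⟩
    q * j + r                                    ≡⟨ qj+r≡m ⟩
    m                                            ∎
  distance : + pb ℤ.- + pa ≡ + j
  distance = trans (cong (λ p → + p ℤ.- + pa) (swap (q * (j + j)) j r)) (+[m+n]-+m≡+n pa j)
    where
    swap : ∀ x y z → x + y + z ≡ x + z + y
    swap = solve-∀

r-fixedPoint : ∀ k j → j ≤ k ∸ 1 → 1 ≤ k → ∀ w → IsFixedPoint (k ∸ j) j 1 w →
               ∀ n → 1 ≤ n → HasR w n ((+ (k * n)) ℤ.- (+ j))
r-fixedPoint k@(suc k′) j j≤k′ _ w fp (suc m) _ =
  let A , nthA = nth-a-exists m in A , _ , nthA , nth-b-after-nth-a nthA , distance A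
  where
  s = k ∸ j
  instance
    s-nonZero : NonZero s
    s-nonZero = >-nonZero (m<n⇒0<n∸m (s≤s j≤k′))
  open FixedPoint s j fp
  r-formula : j + ((s + j) * m + s) ≡ k * suc m
  r-formula = trans (regroup s j m) (cong (_* suc m) (m∸n+n≡m (m≤n⇒m≤1+n j≤k′)))
    where
    regroup : ∀ s j m → j + ((s + j) * m + s) ≡ (s + j) * (1 + m)
    regroup = solve-∀
  distance : ∀ A → + (A + (s + j) * m + s) ℤ.- + A ≡ + (k * suc m) ℤ.- + j
  distance A = begin
    + (A + (s + j) * m + s) ℤ.- + A    ≡⟨ cong (λ p → + p ℤ.- + A) (+-assoc A _ s) ⟩
    + (A + ((s + j) * m + s)) ℤ.- + A  ≡⟨ +[m+n]-+m≡+n A _ ⟩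
    + ((s + j) * m + s)                ≡⟨ +[m+n]-+m≡+n j _ ⟨
    + (j + ((s + j) * m + s)) ℤ.- + j  ≡⟨ cong (λ p → + p ℤ.- + j) r-formula ⟩
    + (k * suc m) ℤ.- + j              ∎

DeleteFirst-head : ∀ {x w v} → w 0 ≡ x → DeleteFirst x w v → ∀ i → v i ≡ w (suc i)
DeleteFirst-head w0≡x (zero  , _ , _      , _ , after) i = after i z≤n
DeleteFirst-head w0≡x (suc p , _ , before , _ , _)     i = contradiction w0≡x (before 0 (s≤s z≤n))

IsD-after-ab : ∀ {w v} → w 0 ≡ a → w 1 ≡ b → IsD w v → ∀ i → v i ≡ w (2 + i)
IsD-after-ab w0≡a w1≡b (u , delete-a , delete-b) i =
  trans (DeleteFirst-head (trans (DeleteFirst-head w0≡a delete-a 0) w1≡b) delete-b i) (DeleteFirst-head w0≡a delete-a (suc i))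

count-after-ab : ∀ {w} → w 0 ≡ a → w 1 ≡ b → ∀ x → count w x 2 ≡ 1
count-after-ab w0≡a w1≡b x = trans (cong₂ (λ y z → (y == x) + (z == x)) w0≡a w1≡b) (==-partition x)

r-D-fixedPoint : ∀ k → 1 ≤ k → ∀ w → IsFixedPoint 1 (k ∸ 1) 1 w → ∀ v → IsD w v →
                 ∀ n → 1 ≤ n → HasR v n (+ (k * n + 1))
r-D-fixedPoint (suc l) _ w fp v w↦v (suc n) _ = shift-by-two (nth-a-exists (suc n))
  where
  open FixedPoint 1 l fp
  w1≡b : w 1 ≡ b
  w1≡b = subst (λ p → w p ≡ b) (cong (_+ 1) (*-zeroʳ (suc l))) (proj₁ (nth-b-after-nth-a (head-a , refl)))
  shift : ∀ {x n} p → NthOcc w x (suc n) (2 + p) → NthOcc v x n p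
  shift p = NthOcc-shift w 2 (IsD-after-ab head-a w1≡b w↦v) (count-after-ab {w} head-a w1≡b _)
  shift-by-two : Σ ℕ (NthOcc w a (2 + n)) → HasR v (suc n) (+ (suc l * suc n + 1))
  shift-by-two (zero , _ , ())
  shift-by-two (suc zero , w1≡a , _) with () ← trans (sym w1≡a) w1≡b
  shift-by-two (suc (suc A) , nthA) =
    A , A + suc l * suc n + 1 , shift A nthA , shift (A + suc l * suc n + 1) (nth-b-after-nth-a nthA) ,
    trans (cong (λ p → + p ℤ.- + A) (+-assoc A _ 1)) (+[m+n]-+m≡+n A _)

theorem5p1 :
    (∀ j → 1 ≤ j → ∀ n → 1 ≤ n → HasR (periodicAB j) n (+ j))
    × (∀ k j → j ≤ k ∸ 1 → 1 ≤ k → ∀ w → IsFixedPoint (k ∸ j) j 1 w →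
         ∀ n → 1 ≤ n → HasR w n ((+ (k * n)) ℤ.- (+ j)))
    × (∀ k → 1 ≤ k → ∀ w → IsFixedPoint 1 (k ∸ 1) 1 w → ∀ v → IsD w v →
         ∀ n → 1 ≤ n → HasR v n (+ (k * n + 1)))
theorem5p1 = r-periodicAB , r-fixedPoint , r-D-fixedPoint
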